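{- Let $G$ be a graph, $v$ a vertex of $G$, and $\rho:U_vG\to G$ the universal homotopy cover. Suppose $f:\widetilde G\to G$ is a homotopy covering map and $\tilde v\in f^{ -1}(v)$. Then there is a unique graph morphism $\tilde\rho:U_vG\to\widetilde G$ such that $\rho=f\circ\tilde\rho$ and $\tilde\rho([v])=\tilde v$, and this $\tilde\rho$ is a homotopy covering map.
   Context: All graphs are undirected, have no multiple edges, may have loops, are connected, and are not a single isolated vertex. Adjacency is written $x\sim y$; a graph morphism preserves adjacency. A walk of length $n$ is a sequence $(v_0\cdots v_n)$ with $v_i\sim v_{i+1}$; $N_2(v)$ is the set of walks of length 2 starting at $v$. A homotopy covering map is a morphism $f:\widetilde G\to G$ such that for every vertex $\tilde v$, applying $f$ vertexwise gives a bijection $N_2(\tilde v)\to N_2(f(\tilde v))$ which respects endpoints (two walks in $N_2(\tilde v)$ end at the same vertex iff their images do). A prune of a walk with $v_i=v_{i+2}$ replaces the segment $v_iv_{i+1}v_i$ by $v_i$. A spider move on a walk $(v_0\cdots v_n)$ replaces one vertex $v_i$, $0<i<n$, by $v_i'$ with $v_{i-1}\sim v_i'\sim v_{i+1}$. Walks are equivalent if connected by finitely many prunes, inverse prunes and spider moves. The fundamental groupoid $\Pi(G)$ has objects the vertices and arrows $v\to w$ the equivalence classes of walks from $v$ to $w$, composed by concatenation ($\alpha*\beta$ = $\alpha$ followed by $\beta$); $\Pi_v(G)$ is the set of arrows with source $v$. The universal homotopy cover $U_vG$ is the graph whose vertices are the arrows in $\Pi_v(G)$, with $\alpha\sim\beta$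 iff $\beta=\alpha*[(wx)]$ for some edge $w\sim x$ of $G$ with $w$ the target of $\alpha$; $\rho:U_vG\to G$ sends an arrow to its target, and $[v]$ denotes the class of the length-0 walk $(v)$. -}

module Defs where

open import Level using (0ℓ)
open import Data.Product using (Σ; Σ-syntax; _×_; _,_; proj₁; proj₂)
open import Relation.Binary.PropositionalEquality using (_≡_; refl; sym; trans; cong)
open import Relation.Binary.Structures using (IsEquivalence)
open import Function.Definitions using (Bijective)
open import Function.Bundles using (_⇔_)

-- Graphs: undirected (symmetric adjacency), loops allowed, no multiple
-- edges (adjacency is proof-irrelevant).  Vertex equality is _≡_.

record Graph : Set₁ where
  field
    V      : Set
    _∼_    : V → V → Set
    ∼-sym  : ∀ {x y} → x ∼ y → y ∼ x
    ∼-prop : ∀ {x y} (p q : x ∼ y) → p ≡ q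
open Graph public

data Walk (G : Graph) : V G → V G → Set where
  []  : ∀ {x} → Walk G x x
  _∷_ : ∀ {x y z} → _∼_ G x y → Walk G y z → Walk G x z

infixr 5 _∷_ _++_

_++_ : ∀ {G x y z} → Walk G x y → Walk G y z → Walk G x z
[]      ++ β = β
(p ∷ α) ++ β = p ∷ (α ++ β)

Connected : Graph → Set
Connected G = ∀ (x y : V G) → Walk G x y

-- not a single isolated vertex (for a connected graph: has an edge)
NotIsolatedVertex : Graph → Set
NotIsolatedVertex G = Σ[ x ∈ V G ] Σ[ y ∈ V G ] _∼_ G x y

data _≃_ {G : Graph} : ∀ {x z} → Walk G x z → Walk G x z → Set where
  prune  : ∀ {x u y z} (α : Walk G x u) (p : _∼_ G u y) (q : _∼_ G y u)
           (β : Walk G u z) → (α ++ p ∷ q ∷ β) ≃ (α ++ β)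
  spider : ∀ {x u y y′ w z} (α : Walk G x u)
           (p : _∼_ G u y) (q : _∼_ G y w) (p′ : _∼_ G u y′) (q′ : _∼_ G y′ w)
           (β : Walk G w z) → (α ++ p ∷ q ∷ β) ≃ (α ++ p′ ∷ q′ ∷ β)
  ≃-refl  : ∀ {x z} {α : Walk G x z} → α ≃ α
  ≃-sym   : ∀ {x z} {α β : Walk G x z} → α ≃ β → β ≃ α
  ≃-trans : ∀ {x z} {α β γ : Walk G x z} → α ≃ β → β ≃ γ → α ≃ γ

-- Setoid graphs (needed because the vertices of U_v G are equivalence
-- classes of walks; there are no quotient types).

record SGraph : Set₁ where
  field
    Vtx   : Set
    _≈_   : Vtx → Vtx → Set
    ≈-equiv : IsEquivalence _≈_
    _~_   : Vtx → Vtx → Set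
open SGraph public

toS : Graph → SGraph
toS G = record
  { Vtx = V G ; _≈_ = _≡_
  ; ≈-equiv = record { refl = refl ; sym = sym ; trans = trans }
  ; _~_ = _∼_ G }

record Morphism (H K : SGraph) : Set where
  field
    fun   : Vtx H → Vtx K
    cong≈ : ∀ {x y} → _≈_ H x y → _≈_ K (fun x) (fun y)
    pres  : ∀ {x y} → _~_ H x y → _~_ K (fun x) (fun y)
open Morphism public

N₂ : (H : SGraph) → Vtx H → Set
N₂ H x = Σ[ a ∈ Vtx H ] Σ[ b ∈ Vtx H ] (_~_ H x a × _~_ H a b)

_≈N₂_ : ∀ {H x} → N₂ H x → N₂ H x → Set
_≈N₂_ {H} (a , b , _) (a′ , b′ , _) = _≈_ H a a′ × _≈_ H b b′

endpoint : ∀ {H x} → N₂ H x → Vtx H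
endpoint (a , b , _) = b

mapN₂ : ∀ {H K} (f : Morphism H K) {x} → N₂ H x → N₂ K (fun f x)
mapN₂ f (a , b , p , q) = fun f a , fun f b , pres f p , pres f q

record IsHomotopyCovering {H K : SGraph} (f : Morphism H K) : Set where
  field
    bijective : ∀ x → Bijective (_≈N₂_ {H} {x}) (_≈N₂_ {K} {fun f x}) (mapN₂ f)
    endpoints : ∀ x (w w′ : N₂ H x) →
                (_≈_ H (endpoint {H} w) (endpoint {H} w′)
                  ⇔ _≈_ K (endpoint {K} (mapN₂ f w)) (endpoint {K} (mapN₂ f w′)))

-- Universal homotopy cover U_v G.
-- A vertex is an arrow of Π_v(G), represented by (target , walk);
-- two representatives are equal iff the walks are equivalent.

Arrow : (G : Graph) → V G → Set
Arrow G v = Σ[ w ∈ V G ] Walk G v w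

data _≈U_ {G : Graph} {v : V G} : Arrow G v → Arrow G v → Set where
  same : ∀ {w} {α β : Walk G v w} → α ≃ β → (w , α) ≈U (w , β)

≈U-equiv : ∀ {G v} → IsEquivalence (_≈U_ {G} {v})
≈U-equiv = record
  { refl  = λ { {w , α} → same ≃-refl }
  ; sym   = λ { (same e) → same (≃-sym e) }
  ; trans = λ { (same e) (same e′) → same (≃-trans e e′) } }

_∼U_ : ∀ {G v} → Arrow G v → Arrow G v → Set
_∼U_ {G} (w , α) (x , β) = Σ[ e ∈ _∼_ G w x ] ((x , α ++ e ∷ []) ≈U (x , β))

U : (G : Graph) → V G → SGraph
U G v = record { Vtx = Arrow G v ; _≈_ = _≈U_ ; ≈-equiv = ≈U-equiv ; _~_ = _∼U_ }

base : ∀ {G} (v : V G) → Arrow G v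
base v = v , []

ρ : (G : Graph) (v : V G) → Morphism (U G v) (toS G)
ρ G v = record
  { fun = proj₁
  ; cong≈ = λ { (same _) → refl }
  ; pres = λ { {w , α} {x , β} (e , _) → e } }

module Submission where

-- Bijectivity of f on 2-walks gives every edge of G a unique lift at each point of
-- a fibre, hence unique lifts of walks.  Lifting a prune returns to the start (the
-- backward edge is lifted by the unique neighbour over its target), and lifting a
-- spider move keeps the endpoint (the endpoint condition of f), so the endpoint of
-- the lift from ṽ is well defined on Π_v(G); this is ρ̃.  In U_v G a neighbour of an
-- arrow is determined by its target, and two 2-walks from an arrow with the same
-- target end at the same arrow (a spider move), so ρ̃ inherits the covering property
-- from ρ = f ∘ ρ̃.  Any σ with ρ = f ∘ σ and σ([v]) = ṽ sends each arrow to the end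
-- of a lift of its walk, so σ = ρ̃.

open import Defs
open import Data.Product using (Σ; Σ-syntax; _×_; _,_; proj₁; proj₂)
open import Relation.Binary.PropositionalEquality
  using (_≡_; refl; sym; trans; cong; subst; subst₂; module ≡-Reasoning)
open import Function.Bundles using (mk⇔; Equivalence)

module _ {G : Graph} where

  ++-assoc : ∀ {x y z w} (α : Walk G x y) (β : Walk G y z) (γ : Walk G z w) →
             (α ++ β) ++ γ ≡ α ++ (β ++ γ)
  ++-assoc []      β γ = refl
  ++-assoc (p ∷ α) β γ = cong (p ∷_) (++-assoc α β γ)

  ++-identityʳ : ∀ {x y} (α : Walk G x y) → α ++ [] ≡ α
  ++-identityʳ []      = refl
  ++-identityʳ (p ∷ α) = cong (p ∷_) (++-identityʳ α)

  ≡⇒≃ : ∀ {x y} {α β : Walk G x y} → α ≡ β → α ≃ β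
  ≡⇒≃ refl = ≃-refl

  ≃-congʳ : ∀ {x y z} {α β : Walk G x y} (γ : Walk G y z) → α ≃ β → (α ++ γ) ≃ (β ++ γ)
  ≃-congʳ γ (prune α p q β) =
    subst₂ _≃_ (sym (++-assoc α (p ∷ q ∷ β) γ)) (sym (++-assoc α β γ))
      (prune α p q (β ++ γ))
  ≃-congʳ γ (spider α p q p′ q′ β) =
    subst₂ _≃_ (sym (++-assoc α (p ∷ q ∷ β) γ)) (sym (++-assoc α (p′ ∷ q′ ∷ β) γ))
      (spider α p q p′ q′ (β ++ γ))
  ≃-congʳ γ ≃-refl         = ≃-refl
  ≃-congʳ γ (≃-sym e)      = ≃-sym (≃-congʳ γ e)
  ≃-congʳ γ (≃-trans e e′) = ≃-trans (≃-congʳ γ e) (≃-congʳ γ e′)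

  spider-snoc : ∀ {x u y y′ w} (α : Walk G x u)
                (p : _∼_ G u y) (q : _∼_ G y w) (p′ : _∼_ G u y′) (q′ : _∼_ G y′ w) →
                ((α ++ p ∷ []) ++ q ∷ []) ≃ ((α ++ p′ ∷ []) ++ q′ ∷ [])
  spider-snoc α p q p′ q′ =
    ≃-trans (≡⇒≃ (++-assoc α (p ∷ []) (q ∷ [])))
      (≃-trans (spider α p q p′ q′ [])
        (≡⇒≃ (sym (++-assoc α (p′ ∷ []) (q′ ∷ [])))))

module _ {G : Graph} {v : V G} where

  ∼U-respˡ : ∀ {a a′ b : Arrow G v} → a ≈U a′ → a ∼U b → a′ ∼U b
  ∼U-respˡ (same h) (e , same h′) = e , same (≃-trans (≃-congʳ (e ∷ []) (≃-sym h)) h′)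

  neighbour-≈U : ∀ {a b b′ : Arrow G v} → a ∼U b → a ∼U b′ → proj₁ b ≡ proj₁ b′ → b ≈U b′
  neighbour-≈U {w , α} (e , same h) (e′ , same h′) refl
    rewrite ∼-prop G e e′ = same (≃-trans (≃-sym h) h′)

  endpoint-≈U : ∀ {a b b′ c c′ : Arrow G v} →
                a ∼U b → b ∼U c → a ∼U b′ → b′ ∼U c′ → proj₁ c ≡ proj₁ c′ → c ≈U c′
  endpoint-≈U {w , α} (p , same hp) (q , same hq) (p′ , same hp′) (q′ , same hq′) refl =
    same (≃-trans (≃-sym hq)
           (≃-trans (≃-congʳ (q ∷ []) (≃-sym hp))
             (≃-trans (spider-snoc α p q p′ q′)
               (≃-trans (≃-congʳ (q′ ∷ []) hp′) hq′))))

module Lifting {G G̃ : Graph} (f : Morphism (toS G̃) (toS G)) (cov : IsHomotopyCovering f) where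
  open IsHomotopyCovering cov

  Fibre : V G → Set
  Fibre x = Σ[ x̃ ∈ V G̃ ] fun f x̃ ≡ x

  fibre-≡ : ∀ {x} {a b : Fibre x} → proj₁ a ≡ proj₁ b → a ≡ b
  fibre-≡ {a = _ , refl} {b = _ , refl} refl = refl

  neighbour-unique : ∀ {x̃ ã b̃} → _∼_ G̃ x̃ ã → _∼_ G̃ x̃ b̃ → fun f ã ≡ fun f b̃ → ã ≡ b̃
  neighbour-unique {x̃} p q eq =
    proj₁ (proj₁ (bijective x̃) {_ , x̃ , p , ∼-sym G̃ p} {_ , x̃ , q , ∼-sym G̃ q} (eq , refl))

  endpoint-unique : ∀ {x̃ ã b̃ ã′ b̃′} →
                    _∼_ G̃ x̃ ã → _∼_ G̃ ã b̃ → _∼_ G̃ x̃ ã′ → _∼_ G̃ ã′ b̃′ →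
                    fun f b̃ ≡ fun f b̃′ → b̃ ≡ b̃′
  endpoint-unique {x̃} p q p′ q′ = Equivalence.from (endpoints x̃ (_ , _ , p , q) (_ , _ , p′ , q′))

  edge-lift : ∀ {x y} (x̃ : Fibre x) → _∼_ G x y → Σ[ ỹ ∈ Fibre y ] _∼_ G̃ (proj₁ x̃) (proj₁ ỹ)
  edge-lift {y = y} (x̃ , refl) e
    with (ã , b̃ , p , q) , preimage ← proj₂ (bijective x̃) (y , fun f x̃ , e , ∼-sym G e) =
    (ã , proj₁ (preimage {ã , b̃ , p , q} (refl , refl))) , p

  lift-edge : ∀ {x y} → Fibre x → _∼_ G x y → Fibre y
  lift-edge x̃ e = proj₁ (edge-lift x̃ e)

  lift-edge-adj : ∀ {x y} (x̃ : Fibre x) (e : _∼_ G x y) → _∼_ G̃ (proj₁ x̃) (proj₁ (lift-edge x̃ e))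
  lift-edge-adj x̃ e = proj₂ (edge-lift x̃ e)

  lift-edge-unique : ∀ {x y} (x̃ : Fibre x) (e : _∼_ G x y) (ỹ : Fibre y) →
                     _∼_ G̃ (proj₁ x̃) (proj₁ ỹ) → ỹ ≡ lift-edge x̃ e
  lift-edge-unique x̃ e ỹ p = fibre-≡ (neighbour-unique p (lift-edge-adj x̃ e)
    (trans (proj₂ ỹ) (sym (proj₂ (lift-edge x̃ e)))))

  lift : ∀ {x z} → Fibre x → Walk G x z → Fibre z
  lift x̃ []      = x̃
  lift x̃ (e ∷ α) = lift (lift-edge x̃ e) α

  lift-++ : ∀ {x y z} (x̃ : Fibre x) (α : Walk G x y) (β : Walk G y z) →
            lift x̃ (α ++ β) ≡ lift (lift x̃ α) β
  lift-++ x̃ []      β = refl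
  lift-++ x̃ (e ∷ α) β = lift-++ (lift-edge x̃ e) α β

  lift-prune : ∀ {u y z} (ũ : Fibre u) (p : _∼_ G u y) (q : _∼_ G y u) (β : Walk G u z) →
               lift ũ (p ∷ q ∷ β) ≡ lift ũ β
  lift-prune ũ p q β =
    cong (λ w̃ → lift w̃ β)
      (sym (lift-edge-unique (lift-edge ũ p) q ũ (∼-sym G̃ (lift-edge-adj ũ p))))

  lift-spider : ∀ {u y y′ w z} (ũ : Fibre u)
                (p : _∼_ G u y) (q : _∼_ G y w) (p′ : _∼_ G u y′) (q′ : _∼_ G y′ w)
                (β : Walk G w z) → lift ũ (p ∷ q ∷ β) ≡ lift ũ (p′ ∷ q′ ∷ β)
  lift-spider ũ p q p′ q′ β =
    cong (λ w̃ → lift w̃ β) (fibre-≡ (endpoint-unique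
      (lift-edge-adj ũ p) (lift-edge-adj (lift-edge ũ p) q)
      (lift-edge-adj ũ p′) (lift-edge-adj (lift-edge ũ p′) q′)
      (trans (proj₂ w̃) (sym (proj₂ w̃′)))))
    where
      w̃  = lift-edge (lift-edge ũ p) q
      w̃′ = lift-edge (lift-edge ũ p′) q′

  lift-resp-≃ : ∀ {x z} (x̃ : Fibre x) {α β : Walk G x z} → α ≃ β → lift x̃ α ≡ lift x̃ β
  lift-resp-≃ x̃ (prune α p q β) = begin
    lift x̃ (α ++ p ∷ q ∷ β)      ≡⟨ lift-++ x̃ α _ ⟩
    lift (lift x̃ α) (p ∷ q ∷ β)  ≡⟨ lift-prune (lift x̃ α) p q β ⟩
    lift (lift x̃ α) β            ≡⟨ sym (lift-++ x̃ α β) ⟩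
    lift x̃ (α ++ β)              ∎
    where open ≡-Reasoning
  lift-resp-≃ x̃ (spider α p q p′ q′ β) = begin
    lift x̃ (α ++ p ∷ q ∷ β)        ≡⟨ lift-++ x̃ α _ ⟩
    lift (lift x̃ α) (p ∷ q ∷ β)    ≡⟨ lift-spider (lift x̃ α) p q p′ q′ β ⟩
    lift (lift x̃ α) (p′ ∷ q′ ∷ β)  ≡⟨ sym (lift-++ x̃ α _) ⟩
    lift x̃ (α ++ p′ ∷ q′ ∷ β)      ∎
    where open ≡-Reasoning
  lift-resp-≃ x̃ ≃-refl         = refl
  lift-resp-≃ x̃ (≃-sym e)      = sym (lift-resp-≃ x̃ e)
  lift-resp-≃ x̃ (≃-trans e e′) = trans (lift-resp-≃ x̃ e) (lift-resp-≃ x̃ e′)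

  module LiftedCover {v : V G} (ṽ : Fibre v) where

    lift-arrow : (a : Arrow G v) → Fibre (proj₁ a)
    lift-arrow (_ , α) = lift ṽ α

    lift-arrow-snoc : ∀ {w x} (α : Walk G v w) (e : _∼_ G w x) →
                      lift-arrow (x , α ++ e ∷ []) ≡ lift-edge (lift-arrow (w , α)) e
    lift-arrow-snoc α e = lift-++ ṽ α (e ∷ [])

    lift-arrow-adj : ∀ {a b} → a ∼U b → _∼_ G̃ (proj₁ (lift-arrow a)) (proj₁ (lift-arrow b))
    lift-arrow-adj {w , α} (e , same h) =
      subst (_∼_ G̃ (proj₁ (lift ṽ α)))
        (cong proj₁ (trans (sym (lift-arrow-snoc α e)) (lift-resp-≃ ṽ h)))
        (lift-edge-adj (lift ṽ α) e)

    ρ̃ : Morphism (U G v) (toS G̃)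
    ρ̃ = record
      { fun   = λ a → proj₁ (lift-arrow a)
      ; cong≈ = λ { (same h) → cong proj₁ (lift-resp-≃ ṽ h) }
      ; pres  = lift-arrow-adj }

    ρ-factors : ∀ a → fun (ρ G v) a ≡ fun f (fun ρ̃ a)
    ρ-factors a = sym (proj₂ (lift-arrow a))

    ρ̃-reflects-target : ∀ a b → fun ρ̃ a ≡ fun ρ̃ b → proj₁ a ≡ proj₁ b
    ρ̃-reflects-target a b eq = trans (ρ-factors a) (trans (cong (fun f) eq) (sym (ρ-factors b)))

    ρ̃-lifts-edge : ∀ a {ã} → _∼_ G̃ (fun ρ̃ a) ã → Σ[ b ∈ Arrow G v ] (a ∼U b × fun ρ̃ b ≡ ã)
    ρ̃-lifts-edge (w , α) {ã} p =
      (fun f ã , α ++ e ∷ []) , (e , same ≃-refl) ,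
      cong proj₁ (trans (lift-arrow-snoc α e) (sym (lift-edge-unique (lift ṽ α) e (ã , refl) p)))
      where
        e : _∼_ G w (fun f ã)
        e = subst (λ x → _∼_ G x (fun f ã)) (proj₂ (lift ṽ α)) (pres f p)

    ρ̃-isHomotopyCovering : IsHomotopyCovering ρ̃
    ρ̃-isHomotopyCovering = record
      { bijective = λ a → (λ {z} {z′} → injective a {z} {z′}) , surjective a
      ; endpoints = λ a (_ , c , ab , bc) (_ , c′ , ab′ , bc′) →
          mk⇔ (cong≈ ρ̃) (λ eq → endpoint-≈U ab bc ab′ bc′ (ρ̃-reflects-target c c′ eq)) }
      where
        injective : ∀ a {z z′ : N₂ (U G v) a} →
                    _≈N₂_ {toS G̃} (mapN₂ ρ̃ z) (mapN₂ ρ̃ z′) → _≈N₂_ {U G v} z z′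
        injective a {b , c , ab , bc} {b′ , c′ , ab′ , bc′} (eb , ec) =
          b≈b′ , neighbour-≈U (∼U-respˡ b≈b′ bc) bc′ (ρ̃-reflects-target c c′ ec)
          where b≈b′ = neighbour-≈U ab ab′ (ρ̃-reflects-target b b′ eb)

        surjective : ∀ a (t : N₂ (toS G̃) (fun ρ̃ a)) →
                     Σ[ z ∈ N₂ (U G v) a ]
                       (∀ {z′} → _≈N₂_ {U G v} z′ z → _≈N₂_ {toS G̃} (mapN₂ ρ̃ z′) t)
        surjective a (ã , b̃ , p , q)
          with b , ab , eb ← ρ̃-lifts-edge a p
          with c , bc , ec ← ρ̃-lifts-edge b (subst (λ x → _∼_ G̃ x b̃) (sym eb) q) =
          (b , c , ab , bc) ,
          λ (hb , hc) → trans (cong≈ ρ̃ hb) eb , trans (cong≈ ρ̃ hc) ec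

    ρ̃-unique : (σ : Morphism (U G v) (toS G̃)) → (∀ a → fun (ρ G v) a ≡ fun f (fun σ a)) →
               fun σ (base v) ≡ proj₁ ṽ → ∀ a → fun σ a ≡ fun ρ̃ a
    ρ̃-unique σ factors σ-base (w , α) =
      cong proj₁ (trans (σ-follows-lift [] α) (cong (λ x̃ → lift x̃ α) (fibre-≡ σ-base)))
      where
        σ-fibre : (a : Arrow G v) → Fibre (proj₁ a)
        σ-fibre a = fun σ a , sym (factors a)

        σ-follows-lift : ∀ {u w} (α : Walk G v u) (β : Walk G u w) →
                         σ-fibre (w , α ++ β) ≡ lift (σ-fibre (u , α)) β
        σ-follows-lift α [] = cong (λ γ → σ-fibre (_ , γ)) (++-identityʳ α)
        σ-follows-lift {u} α (e ∷ β) = begin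
          σ-fibre (_ , α ++ e ∷ β)                ≡⟨ cong (λ γ → σ-fibre (_ , γ)) (sym (++-assoc α (e ∷ []) β)) ⟩
          σ-fibre (_ , (α ++ e ∷ []) ++ β)        ≡⟨ σ-follows-lift (α ++ e ∷ []) β ⟩
          lift (σ-fibre (_ , α ++ e ∷ [])) β      ≡⟨ cong (λ x̃ → lift x̃ β) σ-step ⟩
          lift (lift-edge (σ-fibre (u , α)) e) β  ∎
          where
            open ≡-Reasoning
            σ-step : σ-fibre (_ , α ++ e ∷ []) ≡ lift-edge (σ-fibre (u , α)) e
            σ-step = lift-edge-unique (σ-fibre (u , α)) e _ (pres σ (e , same ≃-refl))

theorem3p17 : (G G̃ : Graph) → Connected G → NotIsolatedVertex G → Connected G̃ → NotIsolatedVertex G̃ →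
    (v : V G) (f : Morphism (toS G̃) (toS G)) → IsHomotopyCovering f →
    (ṽ : V G̃) → fun f ṽ ≡ v →
    Σ[ ρ̃ ∈ Morphism (U G v) (toS G̃) ]
    ((∀ a → fun (ρ G v) a ≡ fun f (fun ρ̃ a))
    × fun ρ̃ (base v) ≡ ṽ
    × IsHomotopyCovering ρ̃
    × (∀ (σ : Morphism (U G v) (toS G̃)) → (∀ a → fun (ρ G v) a ≡ fun f (fun σ a)) →
    fun σ (base v) ≡ ṽ → ∀ a → fun σ a ≡ fun ρ̃ a))
theorem3p17 G G̃ _ _ _ _ v f cov ṽ fṽ≡v =
  ρ̃ , ρ-factors , refl , ρ̃-isHomotopyCovering , ρ̃-unique
  where open Lifting {G} {G̃} f cov
        open LiftedCover (ṽ , fṽ≡v)
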